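{- For non-negative integers $n,\ell,i$ and real numbers $m,r$, $$W_{m,r}(n+\ell,i)=\sum_{j=0}^{\ell}\sum_{k=0}^nW_{m,r}(\ell,j)\binom{n}{k}(mj)^{n-k}W_{m,r}(k,i-j).$$
   Context: The $r$-Whitney numbers of the second kind $W_{m,r}(n,k)$ are defined for integers $n\ge0$ and all integers $k$ by $W_{m,r}(0,0)=1$, $W_{m,r}(n,k)=0$ if $k<0$ or $k>n$, and $W_{m,r}(n,k)=W_{m,r}(n-1,k-1)+(mk+r)W_{m,r}(n-1,k)$ for $n\ge1$; equivalently $(mt+r)^n=\sum_{k=0}^n m^kW_{m,r}(n,k)(t)_k$ with $(t)_k=t(t-1)\cdots(t-k+1)$. The convention $0^0=1$ is used. -}

module Defs where

open import Level using (Level)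
open import Algebra.Bundles using (CommutativeRing)
open import Data.Nat as ℕ using (ℕ; zero; suc)
open import Data.Integer as ℤ using (ℤ; +_; -[1+_])
open import Data.Nat.Combinatorics using (_C_)

-- Everything is parametrised by a commutative ring R (the paper's case is R = ℝ).
module Whitney {c ℓ : Level} (R : CommutativeRing c ℓ) where
  open CommutativeRing R

  fromℕ : ℕ → Carrier
  fromℕ zero    = 0#
  fromℕ (suc n) = 1# + fromℕ n

  fromℤ : ℤ → Carrier
  fromℤ (+ n)      = fromℕ n
  fromℤ -[1+ n ]   = - fromℕ (suc n)

  -- x ^ n with x ^ 0 = 1 (so 0 ^ 0 = 1)
  pow : Carrier → ℕ → Carrier
  pow x zero    = 1#
  pow x (suc n) = x * pow x n

  sumTo : ℕ → (ℕ → Carrier) → Carrier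
  sumTo zero    f = f 0
  sumTo (suc n) f = sumTo n f + f (suc n)

  -- r-Whitney numbers of the second kind W_{m,r}(n,k), n ∈ ℕ, k ∈ ℤ:
  -- W(0,0) = 1, W(0,k) = 0 for k ≠ 0,
  -- W(n,k) = W(n-1,k-1) + (m k + r) W(n-1,k).
  -- (This forces W(n,k) = 0 for k < 0 or k > n.)
  W : Carrier → Carrier → ℕ → ℤ → Carrier
  W m r zero (+ zero)     = 1#
  W m r zero (+ suc _)    = 0#
  W m r zero -[1+ _ ]     = 0#
  W m r (suc n) k = W m r n (k ℤ.- ℤ.+ 1) + ((m * fromℤ k) + r) * W m r n k

  binom : ℕ → ℕ → Carrier
  binom n k = fromℕ (n C k)

--  * Shift of the parameter r (binomial transform).  For every c,
--      Σ_{k≤n} C(n,k) c^{n-k} W_{m,r}(k,x) = W_{m,r+c}(n,x),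
--    because the left side satisfies the Whitney recurrence with r replaced
--    by r + c (Pascal's rule moves one factor c out of the sum).
--  * Convolution.  W_{m,r}(n+l, x) = Σ_{j≤l} W_{m,r}(l,j) W_{m,r+mj}(n, x-j),
--    by induction on n: for n = 0 it is the sifting property of the Kronecker
--    delta W(0,·), and the inductive step is the recurrence, using
--    mx + r = m(x-j) + (r + mj).
--
-- The theorem follows by applying the first fact with c = mj inside the second.

module Submission where

open import Level using (Level)
open import Algebra.Bundles using (CommutativeRing)
open import Data.Nat as ℕ using (ℕ; zero; suc; _∸_; _≤_; _<_; z≤n)
import Data.Nat.Properties as ℕP
open import Data.Nat.Combinatorics using (_C_; k>n⇒nCk≡0; nCk+nC[k+1]≡[n+1]C[k+1])
open import Data.Integer as ℤ using (ℤ; +_; -[1+_])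
import Data.Integer.Properties as ℤP
open import Data.Sum using (inj₁; inj₂)
open import Function using (_∘_)
open import Algebra.Properties.CommutativeSemigroup ℤP.+-commutativeSemigroup using (xy∙z≈xz∙y)
open import Relation.Nullary using (¬_; yes; no)
import Relation.Binary.PropositionalEquality as ≡
open import Defs

module WhitneyConvolution {c ℓ′ : Level} (R : CommutativeRing c ℓ′) where
  open CommutativeRing R renaming (Carrier to A)
  open Whitney R
  open import Relation.Binary.Reasoning.Setoid setoid
  open import Algebra.Solver.Ring.NaturalCoefficients.Default commutativeSemiring
  open import Algebra.Properties.Group +-group using (inverseˡ-unique)

  Σ-cong≤ : ∀ n {f g : ℕ → A} → (∀ k → k ≤ n → f k ≈ g k) → sumTo n f ≈ sumTo n g
  Σ-cong≤ zero    f≈g = f≈g 0 z≤n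
  Σ-cong≤ (suc n) f≈g =
    +-cong (Σ-cong≤ n (λ k k≤n → f≈g k (ℕP.m≤n⇒m≤1+n k≤n))) (f≈g (suc n) ℕP.≤-refl)

  Σ-cong : ∀ n {f g : ℕ → A} → (∀ k → f k ≈ g k) → sumTo n f ≈ sumTo n g
  Σ-cong n f≈g = Σ-cong≤ n (λ k _ → f≈g k)

  Σ-+ : ∀ n (f g : ℕ → A) → sumTo n (λ k → f k + g k) ≈ sumTo n f + sumTo n g
  Σ-+ zero    f g = refl
  Σ-+ (suc n) f g = begin
    sumTo n (λ k → f k + g k) + (f (suc n) + g (suc n))
      ≈⟨ +-cong (Σ-+ n f g) refl ⟩
    (sumTo n f + sumTo n g) + (f (suc n) + g (suc n))
      ≈⟨ solve 4 (λ a b x y → (a :+ b) :+ (x :+ y) := (a :+ x) :+ (b :+ y)) refl _ _ _ _ ⟩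
    (sumTo n f + f (suc n)) + (sumTo n g + g (suc n)) ∎

  Σ-scale : ∀ n (a : A) (f : ℕ → A) → sumTo n (λ k → a * f k) ≈ a * sumTo n f
  Σ-scale zero    a f = refl
  Σ-scale (suc n) a f =
    trans (+-cong (Σ-scale n a f) refl) (sym (distribˡ a (sumTo n f) (f (suc n))))

  Σ-shift : ∀ n (f : ℕ → A) → sumTo (suc n) f ≈ f 0 + sumTo n (f ∘ suc)
  Σ-shift zero    f = refl
  Σ-shift (suc n) f = trans (+-cong (Σ-shift n f) refl) (+-assoc _ _ _)

  Σ-zero : ∀ n {f : ℕ → A} → (∀ k → k ≤ n → f k ≈ 0#) → sumTo n f ≈ 0#
  Σ-zero zero    f≈0 = f≈0 0 z≤n
  Σ-zero (suc n) f≈0 =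
    trans (+-cong (Σ-zero n (λ k k≤n → f≈0 k (ℕP.m≤n⇒m≤1+n k≤n))) (f≈0 (suc n) ℕP.≤-refl))
          (+-identityʳ 0#)

  Σ-single : ∀ n a {f : ℕ → A} → a ≤ n →
             (∀ k → k ≤ n → ¬ k ≡.≡ a → f k ≈ 0#) → sumTo n f ≈ f a
  Σ-single zero    zero z≤n _   = refl
  Σ-single (suc n) a {f} a≤1+n f≈0 with ℕP.m≤n⇒m<n∨m≡n a≤1+n
  ... | inj₁ a<1+n = begin
    sumTo n f + f (suc n)  ≈⟨ +-cong (Σ-single n a (ℕP.≤-pred a<1+n) (λ k k≤n → f≈0 k (ℕP.m≤n⇒m≤1+n k≤n)))
                                     (f≈0 (suc n) ℕP.≤-refl (ℕP.<⇒≢ a<1+n ∘ ≡.sym)) ⟩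
    f a + 0#               ≈⟨ +-identityʳ (f a) ⟩
    f a                    ∎
  ... | inj₂ ≡.refl = begin
    sumTo n f + f (suc n)  ≈⟨ +-cong (Σ-zero n (λ k k≤n → f≈0 k (ℕP.m≤n⇒m≤1+n k≤n) (ℕP.<⇒≢ (ℕ.s≤s k≤n))))
                                     refl ⟩
    0# + f (suc n)         ≈⟨ +-identityˡ (f (suc n)) ⟩
    f (suc n)              ∎

  fromℕ-+ : ∀ a b → fromℕ (a ℕ.+ b) ≈ fromℕ a + fromℕ b
  fromℕ-+ zero    b = sym (+-identityˡ (fromℕ b))
  fromℕ-+ (suc a) b = trans (+-cong refl (fromℕ-+ a b)) (sym (+-assoc _ _ _))

  neg-1+-plus-1 : ∀ y → - (1# + y) + 1# ≈ - y
  neg-1+-plus-1 y = inverseˡ-unique _ y (begin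
    (- (1# + y) + 1#) + y  ≈⟨ +-assoc _ _ _ ⟩
    - (1# + y) + (1# + y)  ≈⟨ -‿inverseˡ _ ⟩
    0#                     ∎)

  fromℤ-suc : ∀ x → fromℤ (x ℤ.+ + 1) ≈ fromℤ x + 1#
  fromℤ-suc (+ n)            = trans (fromℕ-+ n 1) (+-cong refl (+-identityʳ 1#))
  fromℤ-suc -[1+ zero ]      = sym (trans (+-cong (-‿cong (+-identityʳ 1#)) refl) (-‿inverseˡ 1#))
  fromℤ-suc -[1+ suc n ]     = sym (neg-1+-plus-1 (fromℕ (suc n)))

  fromℤ-+ℕ : ∀ x j → fromℤ (x ℤ.+ + j) ≈ fromℤ x + fromℕ j
  fromℤ-+ℕ x zero    = trans (reflexive (≡.cong fromℤ (ℤP.+-identityʳ x))) (sym (+-identityʳ _))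
  fromℤ-+ℕ x (suc j) = begin
    fromℤ (x ℤ.+ + suc j)
      ≈⟨ reflexive (≡.cong fromℤ (≡.sym (ℤP.+-assoc x (+ 1) (+ j)))) ⟩
    fromℤ ((x ℤ.+ + 1) ℤ.+ + j)     ≈⟨ fromℤ-+ℕ (x ℤ.+ + 1) j ⟩
    fromℤ (x ℤ.+ + 1) + fromℕ j     ≈⟨ +-cong (fromℤ-suc x) refl ⟩
    (fromℤ x + 1#) + fromℕ j        ≈⟨ +-assoc _ _ _ ⟩
    fromℤ x + (1# + fromℕ j)        ∎

  fromℤ-split : ∀ x j → fromℤ x ≈ fromℤ (x ℤ.- + j) + fromℕ j
  fromℤ-split x j = begin
    fromℤ x                           ≈⟨ reflexive (≡.cong fromℤ (≡.sym x-j+j≡x)) ⟩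
    fromℤ ((x ℤ.- + j) ℤ.+ + j)       ≈⟨ fromℤ-+ℕ (x ℤ.- + j) j ⟩
    fromℤ (x ℤ.- + j) + fromℕ j       ∎
    where
    x-j+j≡x : (x ℤ.- + j) ℤ.+ + j ≡.≡ x
    x-j+j≡x = ≡.trans (ℤP.+-assoc x (ℤ.- + j) (+ j))
                (≡.trans (≡.cong (λ y → x ℤ.+ y) (ℤP.+-inverseˡ (+ j))) (ℤP.+-identityʳ x))

  W-negative : ∀ m r n a → W m r n -[1+ a ] ≈ 0#
  W-negative m r zero    a = refl
  W-negative m r (suc n) a =
    trans (+-cong (W-negative m r n (suc (a ℕ.+ 0)))
                  (trans (*-cong refl (W-negative m r n a)) (zeroʳ _)))
          (+-identityʳ 0#)

  W-above : ∀ m r n a → n < a → W m r n (+ a) ≈ 0#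
  W-above m r zero    (suc a) _              = refl
  W-above m r (suc n) (suc a) (ℕ.s≤s n<a) =
    trans (+-cong (W-above m r n a n<a)
                  (trans (*-cong refl (W-above m r n (suc a) (ℕP.m<n⇒m<1+n n<a))) (zeroʳ _)))
          (+-identityʳ 0#)

  W-zero-indep : ∀ m r s x → W m r 0 x ≡.≡ W m s 0 x
  W-zero-indep m r s (+ zero)  = ≡.refl
  W-zero-indep m r s (+ suc _) = ≡.refl
  W-zero-indep m r s -[1+ _ ]  = ≡.refl

  δ-diagonal : ∀ m s a → W m s 0 (+ a ℤ.- + a) ≈ 1#
  δ-diagonal m s a = reflexive (≡.cong (W m s 0) (ℤP.+-inverseʳ (+ a)))

  δ-off : ∀ m s a j → ¬ a ≡.≡ j → W m s 0 (+ a ℤ.- + j) ≈ 0#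
  δ-off m s a j a≢j = nonzero (+ a ℤ.- + j) (a≢j ∘ ℤP.+-injective ∘ ℤP.i-j≡0⇒i≡j (+ a) (+ j))
    where
    nonzero : ∀ x → ¬ x ≡.≡ + 0 → W m s 0 x ≈ 0#
    nonzero (+ zero)  x≢0 with () ← x≢0 ≡.refl
    nonzero (+ suc _) _   = refl
    nonzero -[1+ _ ]  _   = refl

  δ-negative : ∀ m s b j → W m s 0 (-[1+ b ] ℤ.- + j) ≈ 0#
  δ-negative m s b zero    = refl
  δ-negative m s b (suc j) = refl

  absorbs : ∀ {x y} → y ≈ 0# → x * y ≈ 0#
  absorbs y≈0 = trans (*-cong refl y≈0) (zeroʳ _)

  W-sift : ∀ m r l (s : ℕ → A) x →
           W m r l x ≈ sumTo l (λ j → W m r l (+ j) * W m (s j) 0 (x ℤ.- + j))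
  W-sift m r l s (+ a) with a ℕP.≤? l
  ... | yes a≤l = sym (begin
    sumTo l (λ j → W m r l (+ j) * W m (s j) 0 (+ a ℤ.- + j))
      ≈⟨ Σ-single l a a≤l (λ j _ j≢a → absorbs (δ-off m (s j) a j (j≢a ∘ ≡.sym))) ⟩
    W m r l (+ a) * W m (s a) 0 (+ a ℤ.- + a)  ≈⟨ *-cong refl (δ-diagonal m (s a) a) ⟩
    W m r l (+ a) * 1#                          ≈⟨ *-identityʳ _ ⟩
    W m r l (+ a)                               ∎)
  ... | no a≰l = trans (W-above m r l a l<a)
                       (sym (Σ-zero l (λ j j≤l → absorbs (δ-off m (s j) a j (a≢j j j≤l)))))
    where
    l<a : l < a
    l<a = ℕP.≰⇒> a≰l
    a≢j : ∀ j → j ≤ l → ¬ a ≡.≡ j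
    a≢j j j≤l ≡.refl = ℕP.<-irrefl ≡.refl (ℕP.≤-<-trans j≤l l<a)
  W-sift m r l s -[1+ b ] =
    trans (W-negative m r l b) (sym (Σ-zero l (λ j _ → absorbs (δ-negative m (s j) b j))))

  binomialTransform : ℕ → A → (ℕ → A) → A
  binomialTransform n c u = sumTo n (λ k → (binom n k * pow c (n ∸ k)) * u k)

  binomialTransform-linear : ∀ n c (u v : ℕ → A) a →
    binomialTransform n c (λ k → u k + a * v k)
      ≈ binomialTransform n c u + a * binomialTransform n c v
  binomialTransform-linear n c u v a = begin
    sumTo n (λ k → b k * (u k + a * v k))
      ≈⟨ Σ-cong n (λ k → solve 4 (λ bk uk vk a → bk :* (uk :+ a :* vk) := bk :* uk :+ a :* (bk :* vk))
                                  refl (b k) (u k) (v k) a) ⟩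
    sumTo n (λ k → b k * u k + a * (b k * v k))
      ≈⟨ trans (Σ-+ n _ _) (+-cong refl (Σ-scale n a _)) ⟩
    binomialTransform n c u + a * binomialTransform n c v  ∎
    where
    b : ℕ → A
    b k = binom n k * pow c (n ∸ k)

  -- Σ_{k≤n+1} C(n,k) c^{n+1-k} u_k = c · BT n c u: the term k = n+1 is zero
  -- and every other exponent n+1-k has one more factor c.
  binomialTransform-raise : ∀ n c (u : ℕ → A) →
    sumTo (suc n) (λ k → (binom n k * pow c (suc n ∸ k)) * u k) ≈ c * binomialTransform n c u
  binomialTransform-raise n c u = begin
    sumTo n g + g (suc n)
      ≈⟨ +-cong refl (trans (*-cong (*-cong (reflexive (≡.cong fromℕ (k>n⇒nCk≡0 (ℕP.n<1+n n)))) refl)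
                                    refl)
                            (trans (*-cong (zeroˡ _) refl) (zeroˡ _))) ⟩
    sumTo n g + 0#
      ≈⟨ +-identityʳ _ ⟩
    sumTo n g
      ≈⟨ Σ-cong≤ n (λ k k≤n → trans
           (*-cong (*-cong refl (reflexive (≡.cong (pow c) (ℕP.+-∸-assoc 1 k≤n)))) refl)
           (solve 4 (λ b c p w → (b :* (c :* p)) :* w := c :* ((b :* p) :* w)) refl _ _ _ _)) ⟩
    sumTo n (λ k → c * ((binom n k * pow c (n ∸ k)) * u k))
      ≈⟨ Σ-scale n c _ ⟩
    c * binomialTransform n c u  ∎
    where
    g : ℕ → A
    g k = (binom n k * pow c (suc n ∸ k)) * u k

  -- Pascal's rule C(n+1,k+1) = C(n,k) + C(n,k+1) gives the recurrence
  --   BT (n+1) c u = c · BT n c u + BT n c (u ∘ suc).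
  binomialTransform-suc : ∀ n c (u : ℕ → A) →
    binomialTransform (suc n) c u ≈ c * binomialTransform n c u + binomialTransform n c (u ∘ suc)
  binomialTransform-suc n c u = begin
    sumTo (suc n) h
      ≈⟨ Σ-shift n h ⟩
    h 0 + sumTo n (h ∘ suc)
      ≈⟨ +-cong refl (trans (Σ-cong n pascal) (Σ-+ n _ _)) ⟩
    g 0 + (sumTo n (g ∘ suc) + binomialTransform n c (u ∘ suc))
      ≈⟨ sym (+-assoc _ _ _) ⟩
    (g 0 + sumTo n (g ∘ suc)) + binomialTransform n c (u ∘ suc)
      ≈⟨ +-cong (trans (sym (Σ-shift n g)) (binomialTransform-raise n c u)) refl ⟩
    c * binomialTransform n c u + binomialTransform n c (u ∘ suc)  ∎
    where
    h g : ℕ → A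
    h k = (binom (suc n) k * pow c (suc n ∸ k)) * u k
    g k = (binom n k * pow c (suc n ∸ k)) * u k
    pascal : ∀ k → h (suc k) ≈ g (suc k) + (binom n k * pow c (n ∸ k)) * u (suc k)
    pascal k = begin
      (fromℕ (suc n C suc k) * p) * u (suc k)
        ≈⟨ *-cong (*-cong (trans (reflexive (≡.cong fromℕ (≡.sym (nCk+nC[k+1]≡[n+1]C[k+1] n k))))
                                 (fromℕ-+ (n C k) (n C suc k))) refl) refl ⟩
      ((binom n k + binom n (suc k)) * p) * u (suc k)
        ≈⟨ solve 4 (λ b₁ b₂ p w → ((b₁ :+ b₂) :* p) :* w := (b₂ :* p) :* w :+ (b₁ :* p) :* w)
                 refl _ _ _ _ ⟩
      g (suc k) + (binom n k * p) * u (suc k)  ∎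
      where
      p : A
      p = pow c (n ∸ k)

  -- The binomial transform of (W_{m,r}(k,x))_k is W_{m,r+c}(n,x): both sides
  -- satisfy the Whitney recurrence with parameter r + c.
  W-shift : ∀ m r c n x →
    binomialTransform n c (λ k → W m r k x) ≈ W m (r + c) n x
  W-shift m r c zero x = begin
    ((1# + 0#) * 1#) * W m r 0 x  ≈⟨ *-cong (trans (*-identityʳ _) (+-identityʳ 1#)) refl ⟩
    1# * W m r 0 x                ≈⟨ *-identityˡ _ ⟩
    W m r 0 x                     ≡⟨ W-zero-indep m r (r + c) x ⟩
    W m (r + c) 0 x               ∎
  W-shift m r c (suc n) x = begin
    binomialTransform (suc n) c (λ k → W m r k x)
      ≈⟨ binomialTransform-suc n c _ ⟩
    c * binomialTransform n c (λ k → W m r k x)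
      + binomialTransform n c (λ k → W m r k (x ℤ.- + 1) + q * W m r k x)
      ≈⟨ +-cong refl (binomialTransform-linear n c _ _ q) ⟩
    c * binomialTransform n c (λ k → W m r k x)
      + (binomialTransform n c (λ k → W m r k (x ℤ.- + 1)) + q * binomialTransform n c (λ k → W m r k x))
      ≈⟨ +-cong (*-cong refl (W-shift m r c n x))
                (+-cong (W-shift m r c n (x ℤ.- + 1)) (*-cong refl (W-shift m r c n x))) ⟩
    c * W m (r + c) n x + (W m (r + c) n (x ℤ.- + 1) + q * W m (r + c) n x)
      ≈⟨ solve 5 (λ c w w′ mx r → c :* w :+ (w′ :+ (mx :+ r) :* w) := w′ :+ (mx :+ (r :+ c)) :* w)
               refl c _ _ (m * fromℤ x) r ⟩
    W m (r + c) (suc n) x  ∎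
    where
    q : A
    q = m * fromℤ x + r

  W-shift-scaled : ∀ m r c n x a →
    a * W m (r + c) n x ≈ sumTo n (λ k → ((a * binom n k) * pow c (n ∸ k)) * W m r k x)
  W-shift-scaled m r c n x a = begin
    a * W m (r + c) n x
      ≈⟨ *-cong refl (sym (W-shift m r c n x)) ⟩
    a * binomialTransform n c (λ k → W m r k x)
      ≈⟨ sym (Σ-scale n a _) ⟩
    sumTo n (λ k → a * ((binom n k * pow c (n ∸ k)) * W m r k x))
      ≈⟨ Σ-cong n (λ k → solve 4 (λ a b p w → a :* ((b :* p) :* w) := ((a :* b) :* p) :* w)
                                  refl a _ _ _) ⟩
    sumTo n (λ k → ((a * binom n k) * pow c (n ∸ k)) * W m r k x)  ∎

  W-convolution : ∀ m r l n x →
    W m r (n ℕ.+ l) x ≈ sumTo l (λ j → W m r l (+ j) * W m (r + m * fromℕ j) n (x ℤ.- + j))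
  W-convolution m r l zero    x = W-sift m r l (λ j → r + m * fromℕ j) x
  W-convolution m r l (suc n) x = begin
    W m r (n ℕ.+ l) (x ℤ.- + 1) + q * W m r (n ℕ.+ l) x
      ≈⟨ +-cong (W-convolution m r l n (x ℤ.- + 1)) (*-cong refl (W-convolution m r l n x)) ⟩
    sumTo l (λ j → a j * V j n ((x ℤ.- + 1) ℤ.- + j)) + q * sumTo l (λ j → a j * V j n (x ℤ.- + j))
      ≈⟨ trans (+-cong refl (sym (Σ-scale l q _))) (sym (Σ-+ l _ _)) ⟩
    sumTo l (λ j → a j * V j n ((x ℤ.- + 1) ℤ.- + j) + q * (a j * V j n (x ℤ.- + j)))
      ≈⟨ Σ-cong l step ⟩
    sumTo l (λ j → a j * V j (suc n) (x ℤ.- + j))  ∎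
    where
    q : A
    q = m * fromℤ x + r
    a : ℕ → A
    a j = W m r l (+ j)
    V : ℕ → ℕ → ℤ → A
    V j = W m (r + m * fromℕ j)
    q-split : ∀ j → q ≈ m * fromℤ (x ℤ.- + j) + (r + m * fromℕ j)
    q-split j = begin
      m * fromℤ x + r                              ≈⟨ +-cong (*-cong refl (fromℤ-split x j)) refl ⟩
      m * (fromℤ (x ℤ.- + j) + fromℕ j) + r
        ≈⟨ solve 4 (λ m y z r → m :* (y :+ z) :+ r := m :* y :+ (r :+ m :* z)) refl m _ _ r ⟩
      m * fromℤ (x ℤ.- + j) + (r + m * fromℕ j)  ∎
    step : ∀ j → a j * V j n ((x ℤ.- + 1) ℤ.- + j) + q * (a j * V j n (x ℤ.- + j))
                 ≈ a j * V j (suc n) (x ℤ.- + j)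
    step j = begin
      a j * V j n ((x ℤ.- + 1) ℤ.- + j) + q * (a j * V j n (x ℤ.- + j))
        ≈⟨ +-cong (*-cong refl (reflexive (≡.cong (V j n) (xy∙z≈xz∙y x (ℤ.- + 1) (ℤ.- + j)))))
                  (*-cong (q-split j) refl) ⟩
      a j * V j n ((x ℤ.- + j) ℤ.- + 1) + q′ * (a j * V j n (x ℤ.- + j))
        ≈⟨ solve 4 (λ a v′ q v → a :* v′ :+ q :* (a :* v) := a :* (v′ :+ q :* v)) refl (a j) _ q′ _ ⟩
      a j * V j (suc n) (x ℤ.- + j)  ∎
      where
      q′ : A
      q′ = m * fromℤ (x ℤ.- + j) + (r + m * fromℕ j)

open CommutativeRing using (Carrier; _≈_; _*_)
open Whitney using (W; sumTo; binom; pow; fromℕ)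

mainTheorem3 : {c ℓ′ : Level} (R : CommutativeRing c ℓ′) →
    (m r : Carrier R) (n l i : ℕ) →
    _≈_ R (W R m r (n ℕ.+ l) (+ i))
    (sumTo R l (λ j → sumTo R n (λ k →
    _*_ R (_*_ R (_*_ R (W R m r l (+ j)) (binom R n k))
    (pow R (_*_ R m (fromℕ R j)) (n ∸ k)))
    (W R m r k (+ i ℤ.- + j)))))
mainTheorem3 R m r n l i =
  trans (W-convolution m r l n (+ i))
        (Σ-cong l (λ j → W-shift-scaled m r (_*_ R m (fromℕ R j)) n (+ i ℤ.- + j) (W R m r l (+ j))))
  where
  open CommutativeRing R using (trans)
  open WhitneyConvolution R using (W-convolution; Σ-cong; W-shift-scaled)
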